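{- $6 \leq g_1(5,2) \leq 7$.
   Context: For a $k$-uniform hypergraph $H$ with vertex set $V$ and $1 \le m \le k-1$: an $m$-matching of $H$ is a set $M$ of edges with $|e \cap e'| < m$ for all distinct $e, e' \in M$; $\nu^{(m)}(H)$ is the maximum size of an $m$-matching. An $m$-cover is a set $C \subseteq \binom{V}{m}$ such that every edge of $H$ contains some member of $C$; $\tau^{(m)}(H)$ is the minimum size of an $m$-cover. $g_1(k,m)$ is the supremum of $\tau^{(m)}(H)/\nu^{(m)}(H)$ over all finite $k$-uniform hypergraphs $H$ with $\nu^{(m)}(H) = 1$. -}

module Defs where

open import Data.Nat using (ℕ; _≤_; _<_)
open import Data.Fin.Subset using (Subset; ∣_∣; _∩_; _⊆_)
open import Data.List using (List; length)
open import Data.List.Membership.Propositional renaming (_∈_ to _∈ₗ_)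
open import Data.List.Relation.Unary.All using (All)
open import Data.List.Relation.Unary.Any using (Any)
open import Data.List.Relation.Unary.Unique.Propositional using (Unique)
open import Data.Product using (Σ; _×_)
open import Relation.Binary.PropositionalEquality using (_≡_; _≢_)

-- A finite k-uniform hypergraph on vertex set Fin n.
-- Edges are given by a list of subsets of Fin n (duplicates are harmless:
-- the edge *set* is the set of list entries), each of cardinality k.
record Hypergraph (k : ℕ) : Set where
  field
    n       : ℕ
    edges   : List (Subset n)
    uniform : All (λ e → ∣ e ∣ ≡ k) edges
open Hypergraph public

IsMatching : ∀ {k} (H : Hypergraph k) (m : ℕ) → List (Subset (n H)) → Set
IsMatching H m M =
  Unique M
  × All (λ e → e ∈ₗ edges H) M
  × (∀ {e e'} → e ∈ₗ M → e' ∈ₗ M → e ≢ e' → ∣ e ∩ e' ∣ < m)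

MatchingNumber : ∀ {k} (H : Hypergraph k) (m s : ℕ) → Set
MatchingNumber H m s =
  Σ (List (Subset (n H))) (λ M → IsMatching H m M × length M ≡ s)
  × (∀ M → IsMatching H m M → length M ≤ s)

IsCover : ∀ {k} (H : Hypergraph k) (m : ℕ) → List (Subset (n H)) → Set
IsCover H m C =
  Unique C
  × All (λ c → ∣ c ∣ ≡ m) C
  × All (λ e → Any (λ c → c ⊆ e) C) (edges H)

CoverNumber : ∀ {k} (H : Hypergraph k) (m t : ℕ) → Set
CoverNumber H m t =
  Σ (List (Subset (n H))) (λ C → IsCover H m C × length C ≡ t)
  × (∀ C → IsCover H m C → t ≤ length C)

{-# OPTIONS --safe #-}
-- Lower bound: the biplane on 11 points, whose blocks are the translates of the quadratic
-- residues {1, 3, 4, 5, 9} modulo 11, is 5-uniform, any two blocks share exactly two points and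
-- any two points lie in at most two blocks. Hence ν^(2) = 1, while a pair covers at most two of
-- the eleven blocks, so τ^(2) ≥ 6.
--
-- Upper bound: if ν^(2)(H) = 1, any two edges of H share at least two vertices. We explore H edge
-- by edge, recording only the traces of the explored edges on the vertices seen so far. A
-- computer-found decision tree lists, at each stage, seven pairs of seen vertices such that every
-- trace a further edge could have (at most 5 vertices, meeting every explored trace in at least 2)
-- either contains one of the pairs or is the trace at which the tree branches, exploring that
-- edge next. Following uncovered edges of H down the tree therefore ends with seven pairs
-- covering all of H.
module Submission where

open import Defs hiding (n)
open import Data.Bool using (Bool; T; _∧_)
open import Data.Bool.Properties using (T-∧)
import Data.Bool.Properties as Bool
open import Data.Empty using (⊥-elim)
open import Data.Fin using (Fin; zero; suc; toℕ; #_)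
import Data.Fin as Fin
open import Data.Fin.Properties using (suc-injective)
open import Data.Fin.Subset
  using (Subset; inside; outside; ∣_∣; _∈_; _∉_; _⊆_; _∩_; _∪_; _─_; _-_; ∁; ⁅_⁆; ⋃; ⊥; ⊤)
open import Data.Fin.Subset.Properties
  using (_∈?_; _⊆?_; ∣⊥∣≡0; ∣⊤∣≡n; ∣⁅x⁆∣≡1; ⊥⊆; ⊆-antisym; p⊆q⇒∣p∣≤∣q∣; p─⊥≡p; p─q⊆p;
         ∪-identityˡ; ∪-identityʳ; ∪-assoc; ∩-idem; ∩-comm; p⊆p∪q; p∩q⊆q; x∈⁅x⁆; x∈⁅y⁆⇒x≡y;
         x≢y⇒x∉⁅y⁆; x∈p∪q⁺; x∈p∪q⁻; x∈p∩q⁺; x∈p∩q⁻; x∉p⇒x∈∁p; x∈∁p⇒x∉p; x∈p∧x∉q⇒x∈p─q)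
open import Data.List using (List; []; _∷_; length; filter; deduplicate)
import Data.List as List
open import Data.List.Membership.Propositional using (find) renaming (_∈_ to _∈ₗ_)
open import Data.List.Properties using (length-map; length-deduplicate)
open import Data.List.Relation.Binary.Sublist.Heterogeneous.Properties using (length-mono-≤)
open import Data.List.Relation.Binary.Sublist.Propositional.Properties using (filter⁺; filter-⊆)
open import Data.List.Relation.Unary.All as All using (All; []; _∷_)
import Data.List.Relation.Unary.All.Properties as All
open import Data.List.Relation.Unary.AllPairs using ([]; _∷_)
open import Data.List.Relation.Unary.Any as Any using (Any; here; there)
import Data.List.Relation.Unary.Any.Properties as Any
open import Data.List.Relation.Unary.Unique.DecPropositional using (unique?)
open import Data.List.Relation.Unary.Unique.DecPropositional.Properties using (deduplicate-!)
open import Data.Nat using (ℕ; zero; suc; _+_; _*_; _≤_; _<_; z≤n; s≤s; _≤?_; _≟_)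
open import Data.Nat.DivMod using (_mod_)
open import Data.Nat.Properties
  using (≤-refl; ≤-reflexive; ≤-trans; ≤-antisym; +-mono-≤; +-suc; +-cancelˡ-≡; *-cancelʳ-<; <⇒≱; ≰⇒>;
         module ≤-Reasoning)
open import Data.Product using (Σ; ∃; _×_; _,_; proj₁; proj₂; uncurry)
open import Data.Sum using (_⊎_; inj₁; inj₂; fromInj₂)
import Data.Unit as Unit
open import Data.Vec using (Vec; []; _∷_; _++_; map; lookup; here; there)
open import Data.Vec.Properties using (lookup-map; lookup-zipWith; map-++; []=⇒lookup; lookup⇒[]=; ≡-dec)
open import Data.Vec.Relation.Unary.All as Allᵥ using ([]; _∷_) renaming (All to Allᵥ)
import Data.Vec.Relation.Unary.All.Properties as Allᵥ
open import Data.Vec.Relation.Unary.AllPairs using ([]; _∷_)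
import Data.Vec.Relation.Unary.AllPairs.Properties as AllPairs
open import Data.Vec.Relation.Unary.Unique.Propositional using (Unique)
import Data.Vec.Relation.Unary.Unique.Propositional.Properties as Unique
open import Function using (id; _∘_; Equivalence)
open import Relation.Binary.PropositionalEquality
  using (_≡_; _≢_; refl; sym; trans; cong; cong₂; subst; ≢-sym; module ≡-Reasoning)
open import Relation.Nullary using (¬_; Dec; yes; no; ¬?; contradiction)
open import Relation.Nullary.Decidable
  using (map′; _×-dec_; _⊎-dec_; _→-dec_; isYes; toWitness; fromWitness; T?; from-yes)
open import Relation.Unary using (Decidable)

private
  variable
    k m n : ℕ
    x y : Fin n
    p q : Subset n

∣b∷p∣≤∣b∷q∣ : ∀ b {p : Subset m} {q : Subset n} → ∣ p ∣ ≤ ∣ q ∣ → ∣ b ∷ p ∣ ≤ ∣ b ∷ q ∣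
∣b∷p∣≤∣b∷q∣ inside  = s≤s
∣b∷p∣≤∣b∷q∣ outside = id

∣b∷inside∷p∣≡1+∣b∷p∣ : ∀ b (p : Subset n) → ∣ b ∷ inside ∷ p ∣ ≡ suc ∣ b ∷ p ∣
∣b∷inside∷p∣≡1+∣b∷p∣ inside  p = refl
∣b∷inside∷p∣≡1+∣b∷p∣ outside p = refl

∣p∣≡∣p[x]∷p-x∣ : ∀ (p : Subset n) x → ∣ p ∣ ≡ ∣ lookup p x ∷ (p - x) ∣
∣p∣≡∣p[x]∷p-x∣ (b ∷ p)       zero    = cong (λ q → ∣ b ∷ q ∣) (sym (p─⊥≡p p))
∣p∣≡∣p[x]∷p-x∣ (outside ∷ p) (suc x) = ∣p∣≡∣p[x]∷p-x∣ p x
∣p∣≡∣p[x]∷p-x∣ (inside ∷ p)  (suc x) =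
  trans (cong suc (∣p∣≡∣p[x]∷p-x∣ p x)) (sym (∣b∷inside∷p∣≡1+∣b∷p∣ (lookup p x) (p - x)))

∣p++q∣≡∣p∣+∣q∣ : ∀ (p : Subset m) (q : Subset n) → ∣ p ++ q ∣ ≡ ∣ p ∣ + ∣ q ∣
∣p++q∣≡∣p∣+∣q∣ []            q = refl
∣p++q∣≡∣p∣+∣q∣ (inside ∷ p)  q = cong suc (∣p++q∣≡∣p∣+∣q∣ p q)
∣p++q∣≡∣p∣+∣q∣ (outside ∷ p) q = ∣p++q∣≡∣p∣+∣q∣ p q

∣⁅x⁆∪⁅y⁆∣≡2 : x ≢ y → ∣ ⁅ x ⁆ ∪ ⁅ y ⁆ ∣ ≡ 2
∣⁅x⁆∪⁅y⁆∣≡2 {x = zero}  {zero}  x≢y = contradiction refl x≢y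
∣⁅x⁆∪⁅y⁆∣≡2 {x = zero}  {suc y} _   =
  cong suc (trans (cong ∣_∣ (∪-identityˡ ⁅ y ⁆)) (∣⁅x⁆∣≡1 y))
∣⁅x⁆∪⁅y⁆∣≡2 {x = suc x} {zero}  _   =
  cong suc (trans (cong ∣_∣ (∪-identityʳ ⁅ x ⁆)) (∣⁅x⁆∣≡1 x))
∣⁅x⁆∪⁅y⁆∣≡2 {x = suc x} {suc y} x≢y = ∣⁅x⁆∪⁅y⁆∣≡2 (x≢y ∘ cong suc)

⁅x⁆∪⁅y⁆⊆p : x ∈ p → y ∈ p → ⁅ x ⁆ ∪ ⁅ y ⁆ ⊆ p
⁅x⁆∪⁅y⁆⊆p {x = x} {p = p} {y = y} x∈p y∈p z∈ with x∈p∪q⁻ ⁅ x ⁆ ⁅ y ⁆ z∈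
... | inj₁ z∈⁅x⁆ = subst (_∈ p) (sym (x∈⁅y⁆⇒x≡y x z∈⁅x⁆)) x∈p
... | inj₂ z∈⁅y⁆ = subst (_∈ p) (sym (x∈⁅y⁆⇒x≡y y z∈⁅y⁆)) y∈p

x∈p─q⇒x∉q : x ∈ p ─ q → x ∉ q
x∈p─q⇒x∉q {p = _ ∷ _} {q = outside ∷ _} here       ()
x∈p─q⇒x∉q {p = _ ∷ _} {q = _ ∷ _}       (there x∈) (there x∈q) = x∈p─q⇒x∉q x∈ x∈q

x∉p⇒p[x]≡outside : x ∉ p → lookup p x ≡ outside
x∉p⇒p[x]≡outside {x = x} {p = p} x∉p with lookup p x in eq
... | inside  = contradiction (lookup⇒[]= x p eq) x∉p
... | outside = refl

p⊆q∪p∩∁q : p ⊆ q ∪ (p ∩ ∁ q)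
p⊆q∪p∩∁q {q = q} {x} x∈p with x ∈? q
... | yes x∈q = x∈p∪q⁺ (inj₁ x∈q)
... | no  x∉q = x∈p∪q⁺ (inj₂ (x∈p∩q⁺ (x∈p , x∉p⇒x∈∁p x∉q)))

module _ {N : ℕ} where

  private
    variable
      X Y : Subset N

  support : Vec (Fin N) n → Subset N
  support []      = ⊥
  support (x ∷ ι) = ⁅ x ⁆ ∪ support ι

  trace : Vec (Fin N) n → Subset N → Subset n
  trace ι X = map (lookup X) ι

  All-∈-support : (ι : Vec (Fin N) n) → Allᵥ (_∈ support ι) ι
  All-∈-support []      = []
  All-∈-support (x ∷ ι) = x∈p∪q⁺ (inj₁ (x∈⁅x⁆ x)) ∷ Allᵥ.map (x∈p∪q⁺ ∘ inj₂) (All-∈-support ι)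

  support-++ : (ι : Vec (Fin N) m) (κ : Vec (Fin N) n) → support (ι ++ κ) ≡ support ι ∪ support κ
  support-++ []      κ = sym (∪-identityˡ (support κ))
  support-++ (x ∷ ι) κ = trans (cong (⁅ x ⁆ ∪_) (support-++ ι κ)) (sym (∪-assoc ⁅ x ⁆ (support ι) (support κ)))

  support-⊆-++ : (ι : Vec (Fin N) m) (κ : Vec (Fin N) n) → support ι ⊆ support (ι ++ κ)
  support-⊆-++ ι κ = subst (support ι ⊆_) (sym (support-++ ι κ)) (p⊆p∪q (support κ))

  ∈-trace⁺ : ∀ (ι : Vec (Fin N) n) X {i} → lookup ι i ∈ X → i ∈ trace ι X
  ∈-trace⁺ ι X {i} ιi∈X = lookup⇒[]= i (trace ι X) (trans (lookup-map i (lookup X) ι) ([]=⇒lookup ιi∈X))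

  ∈-trace⁻ : ∀ (ι : Vec (Fin N) n) X {i} → i ∈ trace ι X → lookup ι i ∈ X
  ∈-trace⁻ ι X {i} i∈ = lookup⇒[]= (lookup ι i) X (trans (sym (lookup-map i (lookup X) ι)) ([]=⇒lookup i∈))

  trace-mono : ∀ (ι : Vec (Fin N) n) → X ⊆ Y → trace ι X ⊆ trace ι Y
  trace-mono {X = X} {Y} ι X⊆Y = ∈-trace⁺ ι Y ∘ X⊆Y ∘ ∈-trace⁻ ι X

  trace⊆trace-─ : ∀ (ι : Vec (Fin N) n) X → Allᵥ (_∉ Y) ι → trace ι X ⊆ trace ι (X ─ Y)
  trace⊆trace-─ {Y = Y} ι X ι∉Y i∈ = ∈-trace⁺ ι (X ─ Y) (x∈p∧x∉q⇒x∈p─q (∈-trace⁻ ι X i∈) (Allᵥ.lookup⁺ ι∉Y _))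

  trace-∩ : ∀ (ι : Vec (Fin N) n) X Y → trace ι (X ∩ Y) ≡ trace ι X ∩ trace ι Y
  trace-∩ []      X Y = refl
  trace-∩ (x ∷ ι) X Y = cong₂ _∷_ (lookup-zipWith _ x X Y) (trace-∩ ι X Y)

  trace-++ : ∀ (ι : Vec (Fin N) m) (κ : Vec (Fin N) n) X → trace (ι ++ κ) X ≡ trace ι X ++ trace κ X
  trace-++ ι κ X = map-++ (lookup X) ι κ

  trace-⊤ : ∀ X {ι : Vec (Fin N) n} → Allᵥ (_∈ X) ι → trace ι X ≡ ⊤
  trace-⊤ X []           = refl
  trace-⊤ X (x∈X ∷ ι⊆X) = cong₂ _∷_ ([]=⇒lookup x∈X) (trace-⊤ X ι⊆X)

  trace-⊥ : ∀ X {ι : Vec (Fin N) n} → Allᵥ (_∉ X) ι → trace ι X ≡ ⊥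
  trace-⊥ X []           = refl
  trace-⊥ X (x∉X ∷ ι∉X) = cong₂ _∷_ (x∉p⇒p[x]≡outside x∉X) (trace-⊥ X ι∉X)

  ∣trace∣≤∣X∣ : ∀ {ι : Vec (Fin N) n} X → Unique ι → ∣ trace ι X ∣ ≤ ∣ X ∣
  ∣trace∣≤∣X∣           X []            = z≤n
  ∣trace∣≤∣X∣ {ι = x ∷ ι} X (x≢ι ∷ ι!) = begin
    ∣ lookup X x ∷ trace ι X ∣  ≤⟨ ∣b∷p∣≤∣b∷q∣ (lookup X x) {p = trace ι X} {q = X - x} tail≤ ⟩
    ∣ lookup X x ∷ (X - x) ∣    ≡⟨ ∣p∣≡∣p[x]∷p-x∣ X x ⟨
    ∣ X ∣                       ∎
    where
    open ≤-Reasoning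
    tail≤ : ∣ trace ι X ∣ ≤ ∣ X - x ∣
    tail≤ = ≤-trans (p⊆q⇒∣p∣≤∣q∣ (trace⊆trace-─ ι X (Allᵥ.map (x≢y⇒x∉⁅y⁆ ∘ ≢-sym) x≢ι))) (∣trace∣≤∣X∣ (X - x) ι!)

  ∣X∣≤∣trace∣ : (ι : Vec (Fin N) n) → X ⊆ support ι → ∣ X ∣ ≤ ∣ trace ι X ∣
  ∣X∣≤∣trace∣ {X = X} []      X⊆⊥ = ≤-reflexive (trans (cong ∣_∣ (⊆-antisym X⊆⊥ ⊥⊆)) (∣⊥∣≡0 N))
  ∣X∣≤∣trace∣ {X = X} (x ∷ ι) X⊆ = begin
    ∣ X ∣                       ≡⟨ ∣p∣≡∣p[x]∷p-x∣ X x ⟩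
    ∣ lookup X x ∷ (X - x) ∣    ≤⟨ ∣b∷p∣≤∣b∷q∣ (lookup X x) {p = X - x} {q = trace ι X} tail≤ ⟩
    ∣ lookup X x ∷ trace ι X ∣  ∎
    where
    open ≤-Reasoning
    X-x⊆ι : X - x ⊆ support ι
    X-x⊆ι y∈ with x∈p∪q⁻ ⁅ x ⁆ (support ι) (X⊆ (p─q⊆p X ⁅ x ⁆ y∈))
    ... | inj₁ y∈⁅x⁆ = contradiction y∈⁅x⁆ (x∈p─q⇒x∉q y∈)
    ... | inj₂ y∈ι   = y∈ι
    tail≤ : ∣ X - x ∣ ≤ ∣ trace ι X ∣
    tail≤ = ≤-trans (∣X∣≤∣trace∣ ι X-x⊆ι) (p⊆q⇒∣p∣≤∣q∣ (trace-mono ι (p─q⊆p X ⁅ x ⁆)))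

  ∣trace∣≡∣X∣ : ∀ {ι : Vec (Fin N) n} → Unique ι → X ⊆ support ι → ∣ trace ι X ∣ ≡ ∣ X ∣
  ∣trace∣≡∣X∣ {X = X} {ι} ι! X⊆ι = ≤-antisym (∣trace∣≤∣X∣ X ι!) (∣X∣≤∣trace∣ ι X⊆ι)

elements : (p : Subset n) → Vec (Fin n) ∣ p ∣
elements []            = []
elements (inside ∷ p)  = zero ∷ map suc (elements p)
elements (outside ∷ p) = map suc (elements p)

support-map-suc : (ι : Vec (Fin n) m) → support (map suc ι) ≡ outside ∷ support ι
support-map-suc []      = refl
support-map-suc (x ∷ ι) = cong (⁅ suc x ⁆ ∪_) (support-map-suc ι)

support-elements : (p : Subset n) → support (elements p) ≡ p
support-elements []            = refl
support-elements (inside ∷ p)  = begin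
  ⁅ zero ⁆ ∪ support (map suc (elements p))  ≡⟨ cong (⁅ zero ⁆ ∪_) (support-map-suc (elements p)) ⟩
  inside ∷ (⊥ ∪ support (elements p))        ≡⟨ cong (inside ∷_) (∪-identityˡ _) ⟩
  inside ∷ support (elements p)              ≡⟨ cong (inside ∷_) (support-elements p) ⟩
  inside ∷ p                                 ∎
  where open ≡-Reasoning
support-elements (outside ∷ p) = trans (support-map-suc (elements p)) (cong (outside ∷_) (support-elements p))

elements-unique : (p : Subset n) → Unique (elements p)
elements-unique []            = []
elements-unique (inside ∷ p)  =
  Allᵥ.map⁺ (Allᵥ.universal (λ _ ()) (elements p)) ∷ Unique.map⁺ suc-injective (elements-unique p)
elements-unique (outside ∷ p) = Unique.map⁺ suc-injective (elements-unique p)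

All-∈-elements : (p : Subset n) → Allᵥ (_∈ p) (elements p)
All-∈-elements p = subst (λ q → Allᵥ (_∈ q) (elements p)) (support-elements p) (All-∈-support (elements p))

module _ {N : ℕ} (ι : Vec (Fin N) n) (X : Subset N) where

  freshVertices : Vec (Fin N) ∣ X ∩ ∁ (support ι) ∣
  freshVertices = elements (X ∩ ∁ (support ι))

  freshVertices-⊆ : Allᵥ (_∈ X) freshVertices
  freshVertices-⊆ = Allᵥ.map (proj₁ ∘ x∈p∩q⁻ X _) (All-∈-elements (X ∩ ∁ (support ι)))

  freshVertices-∉ : Allᵥ (_∉ support ι) freshVertices
  freshVertices-∉ = Allᵥ.map (x∈∁p⇒x∉p ∘ proj₂ ∘ x∈p∩q⁻ X _) (All-∈-elements (X ∩ ∁ (support ι)))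

  unique-++-freshVertices : Unique ι → Unique (ι ++ freshVertices)
  unique-++-freshVertices ι! =
    AllPairs.++⁺ ι! (elements-unique (X ∩ ∁ (support ι))) (Allᵥ.map apart (All-∈-support ι))
    where
    apart : ∀ {x} → x ∈ support ι → Allᵥ (x ≢_) freshVertices
    apart x∈ι = Allᵥ.map (λ y∉ι x≡y → y∉ι (subst (_∈ support ι) x≡y x∈ι)) freshVertices-∉

  ⊆-support-++-freshVertices : X ⊆ support (ι ++ freshVertices)
  ⊆-support-++-freshVertices = subst (X ⊆_) (sym support≡) p⊆q∪p∩∁q
    where
    support≡ : support (ι ++ freshVertices) ≡ support ι ∪ (X ∩ ∁ (support ι))
    support≡ = trans (support-++ ι freshVertices) (cong (support ι ∪_) (support-elements _))

infix 4 _≟ₛ_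
_≟ₛ_ : (p q : Subset n) → Dec (p ≡ q)
_≟ₛ_ = ≡-dec Bool._≟_

length-filter-partition : ∀ {A : Set} {P : A → Set} (P? : ∀ x → Dec (P x)) (xs : List A) →
                          length (filter P? xs) + length (filter (¬? ∘ P?) xs) ≡ length xs
length-filter-partition P? []       = refl
length-filter-partition P? (x ∷ xs) with P? x
... | yes _ = cong suc (length-filter-partition P? xs)
... | no  _ = trans (+-suc _ _) (cong suc (length-filter-partition P? xs))

double-counting : ∀ d (C E : List (Subset n)) → All (λ e → Any (_⊆ e) C) E →
                  All (λ c → length (filter (c ⊆?_) E) ≤ d) C → length E ≤ length C * d
double-counting d []      []      _           _ = z≤n
double-counting d []      (_ ∷ _) (() ∷ _)    _
double-counting d (c ∷ C) E       E-covered (c-few ∷ C-few) = begin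
  length E                                          ≡⟨ length-filter-partition (c ⊆?_) E ⟨
  length (filter (c ⊆?_) E) + length rest           ≤⟨ +-mono-≤ c-few (double-counting d C rest rest-covered rest-few) ⟩
  d + length C * d                                  ∎
  where
  open ≤-Reasoning
  rest = filter (¬? ∘ (c ⊆?_)) E
  coveredByC : ∀ {e} → Any (_⊆ e) (c ∷ C) × ¬ (c ⊆ e) → Any (_⊆ e) C
  coveredByC (here c⊆e , c⊈e) = ⊥-elim (c⊈e c⊆e)
  coveredByC (there any , _)  = any
  rest-covered : All (λ e → Any (_⊆ e) C) rest
  rest-covered = All.zipWith coveredByC (All.filter⁺ (¬? ∘ (c ⊆?_)) E-covered , All.all-filter (¬? ∘ (c ⊆?_)) E)
  rest-few : All (λ c′ → length (filter (c′ ⊆?_) rest) ≤ d) C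
  rest-few = All.map (λ {c′} → ≤-trans (fewer c′)) C-few
    where
    fewer : ∀ c′ → length (filter (c′ ⊆?_) rest) ≤ length (filter (c′ ⊆?_) E)
    fewer c′ = length-mono-≤ (filter⁺ (c′ ⊆?_) (c′ ⊆?_) (λ { refl → id }) (filter-⊆ _ E))

module _ {k} (H : Hypergraph k) where

  private
    variable
      e f : Subset (Hypergraph.n H)

  pair-isMatching : e ∈ₗ edges H → f ∈ₗ edges H → e ≢ f → ∣ e ∩ f ∣ < m → IsMatching H m (e ∷ f ∷ [])
  pair-isMatching {e = e} {f} {m} e∈ f∈ e≢f e∩f<m = ((e≢f ∷ []) ∷ [] ∷ []) , (e∈ ∷ f∈ ∷ []) , small
    where
    small : ∀ {x y} → x ∈ₗ e ∷ f ∷ [] → y ∈ₗ e ∷ f ∷ [] → x ≢ y → ∣ x ∩ y ∣ < m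
    small (here refl)         (here refl)         x≢y = contradiction refl x≢y
    small (here refl)         (there (here refl)) _   = e∩f<m
    small (there (here refl)) (here refl)         _   = subst (λ z → ∣ z ∣ < m) (∩-comm e f) e∩f<m
    small (there (here refl)) (there (here refl)) x≢y = contradiction refl x≢y

  matchingNumber≡1⇒intersecting : m ≤ k → MatchingNumber H m 1 → e ∈ₗ edges H → f ∈ₗ edges H → m ≤ ∣ e ∩ f ∣
  matchingNumber≡1⇒intersecting {m = m} {e = e} {f = f} m≤k (_ , maximal) e∈ f∈ with e ≟ₛ f | m ≤? ∣ e ∩ f ∣
  ... | yes refl | _       = subst (m ≤_) (trans (sym (All.lookup (uniform H) e∈)) (cong ∣_∣ (sym (∩-idem e)))) m≤k
  ... | no _     | yes m≤  = m≤
  ... | no e≢f   | no m≰   =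
    contradiction (maximal (e ∷ f ∷ []) (pair-isMatching e∈ f∈ e≢f (≰⇒> m≰))) λ { (s≤s ()) }

  intersecting⇒matchingNumber≡1 : e ∈ₗ edges H → (∀ {e f} → e ∈ₗ edges H → f ∈ₗ edges H → e ≢ f → m ≤ ∣ e ∩ f ∣) →
                                  MatchingNumber H m 1
  intersecting⇒matchingNumber≡1 {e = e} {m = m} e∈ intersecting =
    (e ∷ [] , ([] ∷ [] , e∈ ∷ [] , single) , refl) , maximal
    where
    single : ∀ {x y} → x ∈ₗ e ∷ [] → y ∈ₗ e ∷ [] → x ≢ y → ∣ x ∩ y ∣ < m
    single (here refl) (here refl) x≢y = contradiction refl x≢y
    maximal : ∀ M → IsMatching H m M → length M ≤ 1
    maximal []          _ = z≤n
    maximal (_ ∷ [])    _ = s≤s z≤n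
    maximal (_ ∷ _ ∷ _) (((x≢y ∷ _) ∷ _) , (x∈ ∷ y∈ ∷ _) , small) =
      contradiction (intersecting x∈ y∈ x≢y) (<⇒≱ (small (here refl) (there (here refl)) x≢y))

  deduplicate-isCover : {C : List (Subset (Hypergraph.n H))} → All (λ c → ∣ c ∣ ≡ m) C →
                        All (λ e → Any (_⊆ e) C) (edges H) → IsCover H m (deduplicate _≟ₛ_ C)
  deduplicate-isCover {C = C} sizes covers =
    deduplicate-! _≟ₛ_ C , All.deduplicate⁺ _≟ₛ_ sizes , All.map (Any.deduplicate⁺ _≟ₛ_ (λ { refl → id })) covers

  isCover? : ∀ m C → Dec (IsCover H m C)
  isCover? m C =
    unique? _≟ₛ_ C ×-dec All.all? (λ c → ∣ c ∣ ≟ m) C ×-dec All.all? (λ e → Any.any? (_⊆? e) C) (edges H)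

-- Checking the certificate runs this enumeration on many predicates; as a boolean function it
-- evaluates markedly faster than the same recursion written with Dec combinators.
allSubsets≤ᵇ : ∀ n → ℕ → (Subset n → Bool) → Bool
allSubsets≤ᵇ zero    b       P = P []
allSubsets≤ᵇ (suc n) zero    P = allSubsets≤ᵇ n zero (λ p → P (outside ∷ p))
allSubsets≤ᵇ (suc n) (suc b) P =
  allSubsets≤ᵇ n (suc b) (λ p → P (outside ∷ p)) ∧ allSubsets≤ᵇ n b (λ p → P (inside ∷ p))

allSubsets≤ᵇ-sound : ∀ n b P → T (allSubsets≤ᵇ n b P) → ∀ p → ∣ p ∣ ≤ b → T (P p)
allSubsets≤ᵇ-sound zero    b       P all []            _     = all
allSubsets≤ᵇ-sound (suc n) zero    P all (outside ∷ p) ∣p∣≤b = allSubsets≤ᵇ-sound n zero _ all p ∣p∣≤b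
allSubsets≤ᵇ-sound (suc n) (suc b) P all (outside ∷ p) ∣p∣≤b =
  allSubsets≤ᵇ-sound n (suc b) _ (proj₁ (Equivalence.to T-∧ all)) p ∣p∣≤b
allSubsets≤ᵇ-sound (suc n) (suc b) P all (inside ∷ p) (s≤s ∣p∣≤b) =
  allSubsets≤ᵇ-sound n b _ (proj₂ (Equivalence.to T-∧ all)) p ∣p∣≤b

allSubsets≤ᵇ-complete : ∀ n b P → (∀ p → ∣ p ∣ ≤ b → T (P p)) → T (allSubsets≤ᵇ n b P)
allSubsets≤ᵇ-complete zero    b       P all = all [] z≤n
allSubsets≤ᵇ-complete (suc n) zero    P all = allSubsets≤ᵇ-complete n zero _ (all ∘ (outside ∷_))
allSubsets≤ᵇ-complete (suc n) (suc b) P all = Equivalence.from T-∧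
  ( allSubsets≤ᵇ-complete n (suc b) _ (all ∘ (outside ∷_))
  , allSubsets≤ᵇ-complete n b _ (λ p ∣p∣≤b → all (inside ∷ p) (s≤s ∣p∣≤b)))

∀-subset≤? : ∀ b {P : Subset n → Set} → Decidable P → Dec (∀ p → ∣ p ∣ ≤ b → P p)
∀-subset≤? {n} b P? = map′
  (λ all p ∣p∣≤b → toWitness (allSubsets≤ᵇ-sound n b _ all p ∣p∣≤b))
  (λ all → allSubsets≤ᵇ-complete n b _ (λ p ∣p∣≤b → fromWitness (all p ∣p∣≤b)))
  (T? (allSubsets≤ᵇ n b (isYes ∘ P?)))

subsetOf : List (Fin n) → Subset n
subsetOf = ⋃ ∘ List.map ⁅_⁆

-- A node on n explored vertices proposes a cover by pairs of them. Each branch gives the trace on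
-- the explored vertices of a further edge and the number of its other vertices, which become the
-- explored vertices n, n + 1, … of the child node.
mutual
  data Certificate (n : ℕ) : Set where
    node : (pairs : List (Fin n × Fin n)) → List (Branch n) → Certificate n

  data Branch (n : ℕ) : Set where
    branch : (oldVertices : List (Fin n)) (fresh : ℕ) → Certificate (n + fresh) → Branch n

branchTrace : Branch n → Subset n
branchTrace (branch vs _ _) = subsetOf vs

Admissible : List (Subset n) → Subset n → Set
Admissible B p = All (λ b → 2 ≤ ∣ p ∩ b ∣) B

-- Stated with lookup rather than _∈_ because _∈?_ is slow to evaluate.
PairIn : Subset n → Fin n × Fin n → Set
PairIn p (a , b) = lookup p a ≡ inside × lookup p b ≡ inside

CoveredBy : List (Fin n × Fin n) → Subset n → Set
CoveredBy C p = Any (PairIn p) C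

extend : List (Subset n) → Subset n → (r : ℕ) → List (Subset (n + r))
extend B p r = (p ++ ⊤) ∷ List.map (_++ ⊥) B

module _ (k t : ℕ) where

  mutual
    Valid : List (Subset n) → Certificate n → Set
    Valid B (node C bs) =
      length C ≤ t × All (uncurry _≢_) C ×
      (∀ p → ∣ p ∣ ≤ k → Admissible B p → CoveredBy C p ⊎ Any ((p ≡_) ∘ branchTrace) bs) ×
      ValidBranches B bs

    ValidBranches : List (Subset n) → List (Branch n) → Set
    ValidBranches B []                   = Unit.⊤
    ValidBranches B (branch vs r c ∷ bs) =
      ∣ subsetOf vs ∣ + r ≡ k × Valid (extend B (subsetOf vs) r) c × ValidBranches B bs

  mutual
    valid? : (B : List (Subset n)) (c : Certificate n) → Dec (Valid B c)
    valid? B (node C bs) =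
      length C ≤? t ×-dec All.all? (λ (a , b) → ¬? (a Fin.≟ b)) C ×-dec
      ∀-subset≤? k (λ p → admissible? p →-dec (covered? p ⊎-dec Any.any? ((p ≟ₛ_) ∘ branchTrace) bs)) ×-dec
      validBranches? B bs
      where
      admissible? : ∀ p → Dec (Admissible B p)
      admissible? p = All.all? (λ b → 2 ≤? ∣ p ∩ b ∣) B
      covered? : ∀ p → Dec (CoveredBy C p)
      covered? p = Any.any? (λ (a , b) → lookup p a Bool.≟ inside ×-dec lookup p b Bool.≟ inside) C

    validBranches? : (B : List (Subset n)) (bs : List (Branch n)) → Dec (ValidBranches B bs)
    validBranches? B []                   = yes _
    validBranches? B (branch vs r c ∷ bs) =
      ∣ subsetOf vs ∣ + r ≟ k ×-dec valid? (extend B (subsetOf vs) r) c ×-dec validBranches? B bs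

-- Soundness of certificates

module Soundness {k : ℕ} (H : Hypergraph k) (t : ℕ)
  (intersecting : ∀ {e f} → e ∈ₗ edges H → f ∈ₗ edges H → 2 ≤ ∣ e ∩ f ∣) where

  private
    N : ℕ
    N = Hypergraph.n H
    variable
      s r : ℕ
      ι : Vec (Fin N) s
      B : List (Subset s)
      e : Subset N

  Realised : Vec (Fin N) s → Subset s → Set
  Realised ι b = ∃ λ e → e ∈ₗ edges H × e ⊆ support ι × trace ι e ≡ b

  SmallCover : Set
  SmallCover = ∃ λ C → IsCover H 2 C × length C ≤ t

  ∣trace∣≤k : Unique ι → e ∈ₗ edges H → ∣ trace ι e ∣ ≤ k
  ∣trace∣≤k {e = e} ι! e∈ = ≤-trans (∣trace∣≤∣X∣ e ι!) (≤-reflexive (All.lookup (uniform H) e∈))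

  trace-admissible : All (Realised ι) B → e ∈ₗ edges H → Admissible B (trace ι e)
  trace-admissible {ι = ι} {e = e} realised e∈ = All.map meets realised
    where
    meets : ∀ {b} → Realised ι b → 2 ≤ ∣ trace ι e ∩ b ∣
    meets (f , f∈ , f⊆ι , refl) = begin
      2                        ≤⟨ intersecting e∈ f∈ ⟩
      ∣ e ∩ f ∣                ≤⟨ ∣X∣≤∣trace∣ ι (f⊆ι ∘ p∩q⊆q e f) ⟩
      ∣ trace ι (e ∩ f) ∣      ≡⟨ cong ∣_∣ (trace-∩ ι e f) ⟩
      ∣ trace ι e ∩ trace ι f ∣ ∎
      where open ≤-Reasoning

  pairAt : Vec (Fin N) s → Fin s × Fin s → Subset N
  pairAt ι (a , b) = ⁅ lookup ι a ⁆ ∪ ⁅ lookup ι b ⁆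

  PairsCover : Vec (Fin N) s → List (Fin s × Fin s) → Subset N → Set
  PairsCover ι C e = Any (_⊆ e) (List.map (pairAt ι) C)

  pairsCover? : ∀ (ι : Vec (Fin N) s) C e → Dec (PairsCover ι C e)
  pairsCover? ι C e = Any.any? (_⊆? e) (List.map (pairAt ι) C)

  coveredBy⇒pairsCover : ∀ (ι : Vec (Fin N) s) {C} → CoveredBy C (trace ι e) → PairsCover ι C e
  coveredBy⇒pairsCover {e = e} ι = Any.map⁺ ∘ Any.map pair⊆e
    where
    pair⊆e : ∀ {ab} → PairIn (trace ι e) ab → pairAt ι ab ⊆ e
    pair⊆e {a , b} (a∈ , b∈) = ⁅x⁆∪⁅y⁆⊆p (∈-trace⁻ ι e (lookup⇒[]= a _ a∈)) (∈-trace⁻ ι e (lookup⇒[]= b _ b∈))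

  pairs⇒smallCover : ∀ {C} → Unique ι → All (uncurry _≢_) C → length C ≤ t →
                     All (PairsCover ι C) (edges H) → SmallCover
  pairs⇒smallCover {ι = ι} {C} ι! distinct length≤t covers =
    deduplicate _≟ₛ_ pairs , deduplicate-isCover H (All.map⁺ (All.map pair-size distinct)) covers , length≤
    where
    pairs = List.map (pairAt ι) C
    pair-size : ∀ {ab} → uncurry _≢_ ab → ∣ pairAt ι ab ∣ ≡ 2
    pair-size {a , b} a≢b = ∣⁅x⁆∪⁅y⁆∣≡2 (a≢b ∘ Unique.lookup-injective ι! a b)
    length≤ : length (deduplicate _≟ₛ_ pairs) ≤ t
    length≤ = ≤-trans (length-deduplicate _≟ₛ_ pairs) (≤-trans (≤-reflexive (length-map (pairAt ι) C)) length≤t)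

  explore : ∀ {p : Subset s} → Unique ι → All (Realised ι) B → e ∈ₗ edges H → trace ι e ≡ p → ∣ p ∣ + r ≡ k →
            ∃ λ (ι′ : Vec (Fin N) (s + r)) → Unique ι′ × All (Realised ι′) (extend B p r)
  explore {s = s} {ι = ι} {B = B} {e = e} {r = r} ι! realised e∈ refl size =
    subst Explored fresh≡r (ι ++ w , unique-++-freshVertices ι e ι! , new ∷ All.map⁺ (All.map old realised))
    where
    w = freshVertices ι e
    Explored : ℕ → Set
    Explored r = ∃ λ (ι′ : Vec (Fin N) (s + r)) → Unique ι′ × All (Realised ι′) (extend B (trace ι e) r)
    trace-e : trace (ι ++ w) e ≡ trace ι e ++ ⊤
    trace-e = trans (trace-++ ι w e) (cong (trace ι e ++_) (trace-⊤ e (freshVertices-⊆ ι e)))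
    new : Realised (ι ++ w) (trace ι e ++ ⊤)
    new = e , e∈ , ⊆-support-++-freshVertices ι e , trace-e
    old : ∀ {b} → Realised ι b → Realised (ι ++ w) (b ++ ⊥)
    old (f , f∈ , f⊆ι , refl) = f , f∈ , support-⊆-++ ι w ∘ f⊆ι ,
      trans (trace-++ ι w f) (cong (trace ι f ++_) (trace-⊥ f w∉f))
      where
      w∉f : Allᵥ (_∉ f) w
      w∉f = Allᵥ.map (λ y∉ι y∈f → y∉ι (f⊆ι y∈f)) (freshVertices-∉ ι e)
    fresh = ∣ e ∩ ∁ (support ι) ∣
    fresh≡r : fresh ≡ r
    fresh≡r = +-cancelˡ-≡ ∣ trace ι e ∣ fresh r (begin
      ∣ trace ι e ∣ + fresh              ≡⟨ cong (∣ trace ι e ∣ +_) (∣⊤∣≡n fresh) ⟨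
      ∣ trace ι e ∣ + ∣ ⊤ {n = fresh} ∣  ≡⟨ ∣p++q∣≡∣p∣+∣q∣ (trace ι e) ⊤ ⟨
      ∣ trace ι e ++ ⊤ ∣                 ≡⟨ cong ∣_∣ trace-e ⟨
      ∣ trace (ι ++ w) e ∣               ≡⟨ ∣trace∣≡∣X∣ (unique-++-freshVertices ι e ι!) (⊆-support-++-freshVertices ι e) ⟩
      ∣ e ∣                              ≡⟨ All.lookup (uniform H) e∈ ⟩
      k                                  ≡⟨ size ⟨
      ∣ trace ι e ∣ + r                  ∎)
      where open ≡-Reasoning

  mutual
    sound : ∀ {c : Certificate s} → Valid k t B c → Unique ι → All (Realised ι) B → SmallCover
    sound {ι = ι} {c = node C bs} (length≤t , distinct , cases , branches) ι! realised
      with All.all? (pairsCover? ι C) (edges H)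
    ... | yes covers  = pairs⇒smallCover ι! distinct length≤t covers
    ... | no ¬covers with find (All.¬All⇒Any¬ (pairsCover? ι C) (edges H) ¬covers)
    ...   | e , e∈ , uncovered with cases (trace ι e) (∣trace∣≤k ι! e∈) (trace-admissible realised e∈)
    ...     | inj₁ covered = contradiction (coveredBy⇒pairsCover ι covered) uncovered
    ...     | inj₂ matches = sound-branches branches ι! realised e∈ matches

    sound-branches : ∀ {bs : List (Branch s)} → ValidBranches k t B bs → Unique ι → All (Realised ι) B →
                     e ∈ₗ edges H → Any ((trace ι e ≡_) ∘ branchTrace) bs → SmallCover
    sound-branches {bs = branch _ _ _ ∷ _} (size , valid , _) ι! realised e∈ (here e↦b)
      with explore ι! realised e∈ e↦b size
    ... | _ , ι′! , realised′ = sound valid ι′! realised′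
    sound-branches {bs = branch _ _ _ ∷ _} (_ , _ , rest) ι! realised e∈ (there matches) =
      sound-branches rest ι! realised e∈ matches

  valid⇒smallCover : ∀ {c : Certificate 0} → Valid k t [] c → SmallCover
  valid⇒smallCover valid = sound valid [] []

-- The certificate for 5-uniform hypergraphs and covers by 7 pairs, found by computer search

c127 : Certificate 10
c127 = node ((# 2 , # 4) ∷ (# 4 , # 5) ∷ (# 0 , # 6) ∷ (# 1 , # 6) ∷ (# 0 , # 7) ∷ (# 3 , # 8) ∷ (# 3 , # 9) ∷ [])
  []

c126 : Certificate 10
c126 = node ((# 0 , # 4) ∷ (# 0 , # 5) ∷ (# 2 , # 5) ∷ (# 0 , # 6) ∷ (# 1 , # 6) ∷ (# 3 , # 7) ∷ (# 3 , # 9) ∷ [])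
  []

c125 : Certificate 10
c125 = node ((# 0 , # 3) ∷ (# 0 , # 4) ∷ (# 1 , # 5) ∷ (# 2 , # 5) ∷ (# 1 , # 6) ∷ (# 3 , # 6) ∷ (# 3 , # 8) ∷ [])
  (branch (# 0 ∷ # 2 ∷ # 6 ∷ # 7 ∷ # 9 ∷ []) 0 c126 ∷ [])

c124 : Certificate 11
c124 = node ((# 2 , # 4) ∷ (# 0 , # 5) ∷ (# 1 , # 6) ∷ (# 3 , # 6) ∷ (# 0 , # 7) ∷ (# 4 , # 8) ∷ (# 9 , # 10) ∷ [])
  []

c123 : Certificate 11
c123 = node ((# 0 , # 4) ∷ (# 2 , # 4) ∷ (# 0 , # 5) ∷ (# 4 , # 5) ∷ (# 1 , # 6) ∷ (# 3 , # 6) ∷ (# 0 , # 7) ∷ [])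
  (branch (# 2 ∷ # 3 ∷ # 5 ∷ # 9 ∷ # 10 ∷ []) 0 c124 ∷ [])

c122 : Certificate 11
c122 = node ((# 2 , # 3) ∷ (# 0 , # 4) ∷ (# 1 , # 5) ∷ (# 2 , # 5) ∷ (# 3 , # 5) ∷ (# 6 , # 9) ∷ (# 6 , # 10) ∷ [])
  []

c121 : Certificate 11
c121 = node ((# 0 , # 3) ∷ (# 2 , # 5) ∷ (# 4 , # 5) ∷ (# 0 , # 6) ∷ (# 3 , # 6) ∷ (# 0 , # 7) ∷ (# 3 , # 8) ∷ [])
  (branch (# 2 ∷ # 4 ∷ # 6 ∷ # 9 ∷ # 10 ∷ []) 0 c122 ∷ [])

c120 : Certificate 9
c120 = node ((# 2 , # 4) ∷ (# 2 , # 5) ∷ (# 4 , # 5) ∷ (# 1 , # 6) ∷ (# 3 , # 6) ∷ (# 0 , # 7) ∷ (# 3 , # 8) ∷ [])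
  (branch (# 0 ∷ # 3 ∷ # 5 ∷ []) 2 c121 ∷ branch (# 0 ∷ # 4 ∷ # 6 ∷ []) 2 c123 ∷ branch (# 0 ∷ # 1 ∷ # 3 ∷ # 5 ∷ []) 1 c125 ∷ branch (# 0 ∷ # 4 ∷ # 6 ∷ # 8 ∷ []) 1 c127 ∷ [])

c119 : Certificate 10
c119 = node ((# 3 , # 4) ∷ (# 3 , # 7) ∷ (# 4 , # 7) ∷ (# 5 , # 8) ∷ (# 6 , # 8) ∷ (# 5 , # 9) ∷ (# 6 , # 9) ∷ [])
  []

c118 : Certificate 10
c118 = node ((# 2 , # 3) ∷ (# 4 , # 5) ∷ (# 2 , # 6) ∷ (# 1 , # 7) ∷ (# 4 , # 7) ∷ (# 3 , # 8) ∷ (# 6 , # 8) ∷ [])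
  []

c117 : Certificate 10
c117 = node ((# 2 , # 3) ∷ (# 2 , # 4) ∷ (# 1 , # 5) ∷ (# 0 , # 6) ∷ (# 1 , # 7) ∷ (# 3 , # 7) ∷ (# 4 , # 9) ∷ [])
  []

c116 : Certificate 10
c116 = node ((# 0 , # 1) ∷ (# 0 , # 3) ∷ (# 1 , # 3) ∷ (# 2 , # 5) ∷ (# 2 , # 7) ∷ (# 4 , # 7) ∷ (# 4 , # 8) ∷ [])
  []

c115 : Certificate 10
c115 = node ((# 0 , # 4) ∷ (# 1 , # 4) ∷ (# 2 , # 4) ∷ (# 3 , # 4) ∷ (# 1 , # 5) ∷ (# 0 , # 6) ∷ (# 3 , # 9) ∷ [])
  (branch (# 0 ∷ # 1 ∷ # 3 ∷ # 7 ∷ # 8 ∷ []) 0 c116 ∷ branch (# 1 ∷ # 2 ∷ # 6 ∷ # 7 ∷ # 9 ∷ []) 0 c117 ∷ [])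

c114 : Certificate 11
c114 = node ((# 0 , # 4) ∷ (# 1 , # 4) ∷ (# 2 , # 4) ∷ (# 3 , # 4) ∷ (# 2 , # 6) ∷ (# 1 , # 7) ∷ (# 3 , # 8) ∷ [])
  []

c113 : Certificate 11
c113 = node ((# 2 , # 3) ∷ (# 3 , # 4) ∷ (# 3 , # 5) ∷ (# 4 , # 5) ∷ (# 1 , # 7) ∷ (# 4 , # 7) ∷ (# 6 , # 9) ∷ [])
  []

c112 : Certificate 11
c112 = node ((# 1 , # 4) ∷ (# 1 , # 5) ∷ (# 2 , # 6) ∷ (# 3 , # 7) ∷ (# 3 , # 8) ∷ (# 7 , # 8) ∷ (# 4 , # 10) ∷ [])
  []

c111 : Certificate 11
c111 = node ((# 2 , # 3) ∷ (# 2 , # 4) ∷ (# 1 , # 5) ∷ (# 0 , # 6) ∷ (# 1 , # 6) ∷ (# 4 , # 7) ∷ (# 3 , # 10) ∷ [])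
  []

c110 : Certificate 12
c110 = node ((# 2 , # 3) ∷ (# 1 , # 4) ∷ (# 0 , # 5) ∷ (# 1 , # 5) ∷ (# 4 , # 6) ∷ (# 4 , # 8) ∷ (# 4 , # 9) ∷ [])
  []

c109 : Certificate 11
c109 = node ((# 2 , # 4) ∷ (# 0 , # 5) ∷ (# 1 , # 5) ∷ (# 3 , # 6) ∷ (# 2 , # 8) ∷ (# 4 , # 8) ∷ (# 4 , # 10) ∷ [])
  (branch (# 3 ∷ # 4 ∷ # 5 ∷ # 9 ∷ []) 1 c110 ∷ branch (# 1 ∷ # 2 ∷ # 6 ∷ # 7 ∷ # 10 ∷ []) 0 c111 ∷ branch (# 1 ∷ # 3 ∷ # 7 ∷ # 8 ∷ # 10 ∷ []) 0 c112 ∷ branch (# 3 ∷ # 4 ∷ # 5 ∷ # 7 ∷ # 9 ∷ []) 0 c113 ∷ [])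

c108 : Certificate 11
c108 = node ((# 1 , # 4) ∷ (# 0 , # 6) ∷ (# 4 , # 6) ∷ (# 1 , # 7) ∷ (# 4 , # 8) ∷ (# 3 , # 9) ∷ (# 4 , # 9) ∷ [])
  []

c107 : Certificate 11
c107 = node ((# 0 , # 4) ∷ (# 1 , # 4) ∷ (# 2 , # 4) ∷ (# 3 , # 4) ∷ (# 1 , # 5) ∷ (# 0 , # 6) ∷ (# 3 , # 9) ∷ [])
  []

c106 : Certificate 10
c106 = node ((# 3 , # 4) ∷ (# 1 , # 5) ∷ (# 3 , # 6) ∷ (# 4 , # 6) ∷ (# 1 , # 7) ∷ (# 0 , # 8) ∷ (# 2 , # 9) ∷ [])
  (branch (# 0 ∷ # 4 ∷ # 5 ∷ # 9 ∷ []) 1 c107 ∷ branch (# 0 ∷ # 4 ∷ # 7 ∷ # 9 ∷ []) 1 c108 ∷ branch (# 2 ∷ # 4 ∷ # 5 ∷ # 8 ∷ []) 1 c109 ∷ branch (# 2 ∷ # 4 ∷ # 7 ∷ # 8 ∷ []) 1 c114 ∷ branch (# 0 ∷ # 4 ∷ # 5 ∷ # 7 ∷ # 9 ∷ []) 0 c115 ∷ branch (# 2 ∷ # 4 ∷ # 5 ∷ # 7 ∷ # 8 ∷ []) 0 c118 ∷ [])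

c105 : Certificate 10
c105 = node ((# 1 , # 3) ∷ (# 1 , # 4) ∷ (# 3 , # 4) ∷ (# 0 , # 8) ∷ (# 2 , # 8) ∷ (# 0 , # 9) ∷ (# 2 , # 9) ∷ [])
  []

c104 : Certificate 10
c104 = node ((# 0 , # 2) ∷ (# 1 , # 6) ∷ (# 3 , # 7) ∷ (# 5 , # 7) ∷ (# 2 , # 8) ∷ (# 3 , # 9) ∷ (# 4 , # 9) ∷ [])
  []

c103 : Certificate 11
c103 = node ((# 1 , # 3) ∷ (# 2 , # 3) ∷ (# 3 , # 4) ∷ (# 0 , # 6) ∷ (# 0 , # 7) ∷ (# 2 , # 7) ∷ (# 4 , # 9) ∷ [])
  []

c102 : Certificate 10
c102 = node ((# 0 , # 1) ∷ (# 0 , # 3) ∷ (# 1 , # 3) ∷ (# 2 , # 6) ∷ (# 2 , # 7) ∷ (# 4 , # 7) ∷ (# 4 , # 9) ∷ [])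
  (branch (# 2 ∷ # 3 ∷ # 5 ∷ # 9 ∷ []) 1 c103 ∷ branch (# 2 ∷ # 3 ∷ # 5 ∷ # 8 ∷ # 9 ∷ []) 0 c104 ∷ [])

c101 : Certificate 10
c101 = node ((# 2 , # 3) ∷ (# 1 , # 4) ∷ (# 2 , # 4) ∷ (# 3 , # 6) ∷ (# 1 , # 7) ∷ (# 3 , # 8) ∷ (# 0 , # 9) ∷ [])
  []

c100 : Certificate 10
c100 = node ((# 0 , # 3) ∷ (# 3 , # 5) ∷ (# 0 , # 6) ∷ (# 3 , # 6) ∷ (# 1 , # 7) ∷ (# 2 , # 7) ∷ (# 4 , # 8) ∷ [])
  (branch (# 1 ∷ # 2 ∷ # 3 ∷ # 4 ∷ # 9 ∷ []) 0 c101 ∷ [])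

c99 : Certificate 10
c99 = node ((# 1 , # 2) ∷ (# 1 , # 3) ∷ (# 2 , # 3) ∷ (# 0 , # 5) ∷ (# 0 , # 7) ∷ (# 4 , # 7) ∷ (# 4 , # 9) ∷ [])
  []

c98 : Certificate 11
c98 = node ((# 2 , # 3) ∷ (# 0 , # 5) ∷ (# 1 , # 5) ∷ (# 1 , # 7) ∷ (# 3 , # 7) ∷ (# 3 , # 8) ∷ (# 4 , # 8) ∷ [])
  []

c97 : Certificate 11
c97 = node ((# 3 , # 4) ∷ (# 0 , # 5) ∷ (# 0 , # 6) ∷ (# 3 , # 7) ∷ (# 4 , # 7) ∷ (# 1 , # 8) ∷ (# 1 , # 9) ∷ [])
  []

c96 : Certificate 10
c96 = node ((# 2 , # 3) ∷ (# 0 , # 5) ∷ (# 1 , # 6) ∷ (# 2 , # 7) ∷ (# 3 , # 7) ∷ (# 4 , # 8) ∷ (# 1 , # 9) ∷ [])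
  (branch (# 0 ∷ # 1 ∷ # 4 ∷ # 7 ∷ []) 1 c97 ∷ branch (# 1 ∷ # 3 ∷ # 5 ∷ # 8 ∷ []) 1 c98 ∷ [])

c95 : Certificate 11
c95 = node ((# 3 , # 4) ∷ (# 0 , # 5) ∷ (# 1 , # 5) ∷ (# 2 , # 5) ∷ (# 3 , # 7) ∷ (# 4 , # 7) ∷ (# 6 , # 10) ∷ [])
  []

c94 : Certificate 12
c94 = node ((# 0 , # 3) ∷ (# 1 , # 3) ∷ (# 2 , # 3) ∷ (# 0 , # 4) ∷ (# 3 , # 4) ∷ (# 1 , # 7) ∷ (# 2 , # 7) ∷ [])
  []

c93 : Certificate 12
c93 = node ((# 0 , # 3) ∷ (# 0 , # 4) ∷ (# 3 , # 4) ∷ (# 3 , # 5) ∷ (# 3 , # 6) ∷ (# 1 , # 7) ∷ (# 2 , # 7) ∷ [])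
  []

c92 : Certificate 10
c92 = node ((# 1 , # 3) ∷ (# 2 , # 3) ∷ (# 0 , # 5) ∷ (# 3 , # 6) ∷ (# 0 , # 7) ∷ (# 4 , # 8) ∷ (# 4 , # 9) ∷ [])
  (branch (# 0 ∷ # 3 ∷ # 4 ∷ []) 2 c93 ∷ branch (# 3 ∷ # 4 ∷ # 7 ∷ []) 2 c94 ∷ branch (# 3 ∷ # 4 ∷ # 5 ∷ # 7 ∷ []) 1 c95 ∷ branch (# 1 ∷ # 2 ∷ # 5 ∷ # 7 ∷ # 8 ∷ []) 0 c96 ∷ branch (# 1 ∷ # 2 ∷ # 5 ∷ # 7 ∷ # 9 ∷ []) 0 c99 ∷ branch (# 1 ∷ # 2 ∷ # 6 ∷ # 7 ∷ # 8 ∷ []) 0 c100 ∷ branch (# 1 ∷ # 2 ∷ # 6 ∷ # 7 ∷ # 9 ∷ []) 0 c102 ∷ [])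

c91 : Certificate 11
c91 = node ((# 3 , # 4) ∷ (# 3 , # 5) ∷ (# 3 , # 6) ∷ (# 3 , # 7) ∷ (# 4 , # 8) ∷ (# 4 , # 9) ∷ (# 4 , # 10) ∷ [])
  []

c90 : Certificate 8
c90 = node ((# 0 , # 4) ∷ (# 2 , # 4) ∷ (# 1 , # 5) ∷ (# 3 , # 5) ∷ (# 3 , # 6) ∷ (# 1 , # 7) ∷ (# 2 , # 7) ∷ [])
  (branch (# 3 ∷ # 4 ∷ []) 3 c91 ∷ branch (# 0 ∷ # 3 ∷ # 7 ∷ []) 2 c92 ∷ branch (# 1 ∷ # 3 ∷ # 4 ∷ []) 2 c105 ∷ branch (# 1 ∷ # 4 ∷ # 6 ∷ []) 2 c106 ∷ branch (# 3 ∷ # 4 ∷ # 7 ∷ []) 2 c119 ∷ branch (# 0 ∷ # 2 ∷ # 5 ∷ # 6 ∷ []) 1 c120 ∷ [])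

c89 : Certificate 10
c89 = node ((# 0 , # 4) ∷ (# 3 , # 4) ∷ (# 1 , # 6) ∷ (# 2 , # 6) ∷ (# 0 , # 7) ∷ (# 1 , # 8) ∷ (# 2 , # 8) ∷ [])
  []

c88 : Certificate 10
c88 = node ((# 0 , # 4) ∷ (# 3 , # 4) ∷ (# 1 , # 5) ∷ (# 2 , # 5) ∷ (# 0 , # 7) ∷ (# 1 , # 9) ∷ (# 2 , # 9) ∷ [])
  []

c87 : Certificate 11
c87 = node ((# 1 , # 4) ∷ (# 1 , # 6) ∷ (# 3 , # 7) ∷ (# 4 , # 7) ∷ (# 2 , # 8) ∷ (# 4 , # 8) ∷ (# 4 , # 9) ∷ [])
  []

c86 : Certificate 11
c86 = node ((# 0 , # 4) ∷ (# 1 , # 4) ∷ (# 2 , # 4) ∷ (# 3 , # 4) ∷ (# 1 , # 5) ∷ (# 3 , # 7) ∷ (# 2 , # 9) ∷ [])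
  []

c85 : Certificate 11
c85 = node ((# 2 , # 3) ∷ (# 1 , # 6) ∷ (# 0 , # 7) ∷ (# 4 , # 7) ∷ (# 2 , # 8) ∷ (# 4 , # 8) ∷ (# 4 , # 9) ∷ [])
  []

c84 : Certificate 11
c84 = node ((# 1 , # 4) ∷ (# 4 , # 5) ∷ (# 1 , # 6) ∷ (# 5 , # 7) ∷ (# 2 , # 8) ∷ (# 4 , # 8) ∷ (# 2 , # 10) ∷ [])
  []

c83 : Certificate 11
c83 = node ((# 0 , # 3) ∷ (# 1 , # 6) ∷ (# 4 , # 6) ∷ (# 0 , # 7) ∷ (# 4 , # 7) ∷ (# 2 , # 8) ∷ (# 4 , # 9) ∷ [])
  []

c82 : Certificate 11
c82 = node ((# 1 , # 4) ∷ (# 0 , # 5) ∷ (# 1 , # 6) ∷ (# 0 , # 7) ∷ (# 4 , # 7) ∷ (# 2 , # 8) ∷ (# 4 , # 10) ∷ [])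
  []

c81 : Certificate 11
c81 = node ((# 0 , # 2) ∷ (# 0 , # 4) ∷ (# 1 , # 4) ∷ (# 2 , # 4) ∷ (# 3 , # 4) ∷ (# 1 , # 6) ∷ (# 7 , # 8) ∷ [])
  (branch (# 0 ∷ # 1 ∷ # 5 ∷ # 7 ∷ # 10 ∷ []) 0 c82 ∷ branch (# 0 ∷ # 3 ∷ # 6 ∷ # 7 ∷ # 9 ∷ []) 0 c83 ∷ branch (# 1 ∷ # 2 ∷ # 5 ∷ # 8 ∷ # 10 ∷ []) 0 c84 ∷ branch (# 2 ∷ # 3 ∷ # 6 ∷ # 8 ∷ # 9 ∷ []) 0 c85 ∷ [])

c80 : Certificate 11
c80 = node ((# 3 , # 4) ∷ (# 1 , # 5) ∷ (# 4 , # 5) ∷ (# 1 , # 6) ∷ (# 0 , # 7) ∷ (# 2 , # 9) ∷ (# 4 , # 9) ∷ [])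
  []

c79 : Certificate 11
c79 = node ((# 2 , # 4) ∷ (# 4 , # 5) ∷ (# 1 , # 6) ∷ (# 1 , # 7) ∷ (# 5 , # 8) ∷ (# 2 , # 9) ∷ (# 8 , # 10) ∷ [])
  []

c78 : Certificate 11
c78 = node ((# 0 , # 3) ∷ (# 1 , # 5) ∷ (# 4 , # 6) ∷ (# 0 , # 7) ∷ (# 4 , # 7) ∷ (# 2 , # 9) ∷ (# 4 , # 9) ∷ [])
  []

c77 : Certificate 11
c77 = node ((# 0 , # 4) ∷ (# 0 , # 7) ∷ (# 1 , # 7) ∷ (# 4 , # 7) ∷ (# 5 , # 8) ∷ (# 2 , # 9) ∷ (# 4 , # 10) ∷ [])
  []

c76 : Certificate 11
c76 = node ((# 0 , # 1) ∷ (# 2 , # 4) ∷ (# 4 , # 5) ∷ (# 4 , # 6) ∷ (# 4 , # 7) ∷ (# 5 , # 7) ∷ (# 2 , # 9) ∷ [])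
  (branch (# 0 ∷ # 2 ∷ # 7 ∷ # 8 ∷ # 10 ∷ []) 0 c77 ∷ branch (# 0 ∷ # 3 ∷ # 6 ∷ # 7 ∷ # 9 ∷ []) 0 c78 ∷ branch (# 1 ∷ # 2 ∷ # 5 ∷ # 8 ∷ # 10 ∷ []) 0 c79 ∷ branch (# 1 ∷ # 3 ∷ # 5 ∷ # 6 ∷ # 9 ∷ []) 0 c80 ∷ [])

c75 : Certificate 10
c75 = node ((# 1 , # 2) ∷ (# 1 , # 4) ∷ (# 2 , # 4) ∷ (# 0 , # 7) ∷ (# 3 , # 7) ∷ (# 5 , # 8) ∷ (# 6 , # 9) ∷ [])
  (branch (# 0 ∷ # 4 ∷ # 5 ∷ # 9 ∷ []) 1 c76 ∷ branch (# 0 ∷ # 4 ∷ # 6 ∷ # 8 ∷ []) 1 c81 ∷ branch (# 3 ∷ # 4 ∷ # 5 ∷ # 9 ∷ []) 1 c86 ∷ branch (# 3 ∷ # 4 ∷ # 6 ∷ # 8 ∷ []) 1 c87 ∷ branch (# 0 ∷ # 3 ∷ # 4 ∷ # 5 ∷ # 9 ∷ []) 0 c88 ∷ branch (# 0 ∷ # 3 ∷ # 4 ∷ # 6 ∷ # 8 ∷ []) 0 c89 ∷ [])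

c74 : Certificate 10
c74 = node ((# 1 , # 3) ∷ (# 1 , # 6) ∷ (# 3 , # 7) ∷ (# 6 , # 7) ∷ (# 2 , # 8) ∷ (# 4 , # 8) ∷ (# 2 , # 9) ∷ [])
  []

c73 : Certificate 10
c73 = node ((# 0 , # 1) ∷ (# 1 , # 5) ∷ (# 0 , # 7) ∷ (# 5 , # 7) ∷ (# 2 , # 8) ∷ (# 2 , # 9) ∷ (# 4 , # 9) ∷ [])
  []

c72 : Certificate 11
c72 = node ((# 0 , # 2) ∷ (# 1 , # 2) ∷ (# 2 , # 3) ∷ (# 2 , # 4) ∷ (# 1 , # 6) ∷ (# 3 , # 7) ∷ (# 4 , # 9) ∷ [])
  []

c71 : Certificate 11
c71 = node ((# 1 , # 2) ∷ (# 1 , # 6) ∷ (# 2 , # 7) ∷ (# 3 , # 7) ∷ (# 2 , # 8) ∷ (# 4 , # 8) ∷ (# 2 , # 9) ∷ [])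
  []

c70 : Certificate 11
c70 = node ((# 0 , # 2) ∷ (# 1 , # 2) ∷ (# 2 , # 3) ∷ (# 2 , # 4) ∷ (# 1 , # 5) ∷ (# 0 , # 7) ∷ (# 4 , # 9) ∷ [])
  []

c69 : Certificate 11
c69 = node ((# 0 , # 2) ∷ (# 1 , # 5) ∷ (# 2 , # 5) ∷ (# 0 , # 7) ∷ (# 2 , # 8) ∷ (# 4 , # 8) ∷ (# 2 , # 10) ∷ [])
  []

c68 : Certificate 10
c68 = node ((# 1 , # 2) ∷ (# 3 , # 5) ∷ (# 0 , # 6) ∷ (# 1 , # 7) ∷ (# 2 , # 7) ∷ (# 4 , # 8) ∷ (# 4 , # 9) ∷ [])
  (branch (# 0 ∷ # 2 ∷ # 5 ∷ # 8 ∷ []) 1 c69 ∷ branch (# 0 ∷ # 2 ∷ # 5 ∷ # 9 ∷ []) 1 c70 ∷ branch (# 2 ∷ # 3 ∷ # 6 ∷ # 8 ∷ []) 1 c71 ∷ branch (# 2 ∷ # 3 ∷ # 6 ∷ # 9 ∷ []) 1 c72 ∷ branch (# 0 ∷ # 2 ∷ # 5 ∷ # 8 ∷ # 9 ∷ []) 0 c73 ∷ branch (# 2 ∷ # 3 ∷ # 6 ∷ # 8 ∷ # 9 ∷ []) 0 c74 ∷ [])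

c67 : Certificate 10
c67 = node ((# 1 , # 4) ∷ (# 3 , # 4) ∷ (# 0 , # 5) ∷ (# 2 , # 5) ∷ (# 1 , # 6) ∷ (# 0 , # 8) ∷ (# 2 , # 8) ∷ [])
  []

c66 : Certificate 11
c66 = node ((# 0 , # 4) ∷ (# 1 , # 4) ∷ (# 2 , # 4) ∷ (# 3 , # 4) ∷ (# 0 , # 5) ∷ (# 3 , # 6) ∷ (# 2 , # 8) ∷ [])
  []

c65 : Certificate 11
c65 = node ((# 2 , # 4) ∷ (# 0 , # 5) ∷ (# 1 , # 5) ∷ (# 3 , # 5) ∷ (# 2 , # 6) ∷ (# 4 , # 6) ∷ (# 7 , # 10) ∷ [])
  []

c64 : Certificate 11
c64 = node ((# 0 , # 4) ∷ (# 0 , # 5) ∷ (# 1 , # 6) ∷ (# 4 , # 6) ∷ (# 2 , # 8) ∷ (# 4 , # 8) ∷ (# 4 , # 9) ∷ [])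
  []

c63 : Certificate 11
c63 = node ((# 0 , # 4) ∷ (# 0 , # 6) ∷ (# 4 , # 6) ∷ (# 1 , # 8) ∷ (# 2 , # 8) ∷ (# 3 , # 8) ∷ (# 9 , # 10) ∷ [])
  []

c62 : Certificate 12
c62 = node ((# 0 , # 2) ∷ (# 0 , # 4) ∷ (# 1 , # 4) ∷ (# 2 , # 4) ∷ (# 3 , # 4) ∷ (# 1 , # 6) ∷ (# 3 , # 6) ∷ [])
  []

c61 : Certificate 12
c61 = node ((# 0 , # 4) ∷ (# 1 , # 4) ∷ (# 2 , # 4) ∷ (# 3 , # 4) ∷ (# 0 , # 5) ∷ (# 2 , # 6) ∷ (# 0 , # 7) ∷ [])
  []

c60 : Certificate 10
c60 = node ((# 0 , # 2) ∷ (# 0 , # 5) ∷ (# 1 , # 6) ∷ (# 3 , # 6) ∷ (# 4 , # 7) ∷ (# 2 , # 8) ∷ (# 4 , # 9) ∷ [])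
  (branch (# 0 ∷ # 4 ∷ # 6 ∷ []) 2 c61 ∷ branch (# 2 ∷ # 4 ∷ # 6 ∷ []) 2 c62 ∷ branch (# 0 ∷ # 4 ∷ # 6 ∷ # 8 ∷ []) 1 c63 ∷ branch (# 1 ∷ # 4 ∷ # 5 ∷ # 8 ∷ []) 1 c64 ∷ branch (# 2 ∷ # 4 ∷ # 5 ∷ # 6 ∷ []) 1 c65 ∷ branch (# 3 ∷ # 4 ∷ # 5 ∷ # 8 ∷ []) 1 c66 ∷ branch (# 1 ∷ # 3 ∷ # 4 ∷ # 5 ∷ # 8 ∷ []) 0 c67 ∷ [])

c59 : Certificate 10
c59 = node ((# 0 , # 3) ∷ (# 0 , # 5) ∷ (# 3 , # 6) ∷ (# 5 , # 6) ∷ (# 2 , # 8) ∷ (# 4 , # 8) ∷ (# 2 , # 9) ∷ [])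
  []

c58 : Certificate 10
c58 = node ((# 0 , # 1) ∷ (# 1 , # 6) ∷ (# 0 , # 7) ∷ (# 6 , # 7) ∷ (# 2 , # 8) ∷ (# 4 , # 8) ∷ (# 2 , # 9) ∷ [])
  []

c57 : Certificate 11
c57 = node ((# 0 , # 2) ∷ (# 1 , # 2) ∷ (# 2 , # 3) ∷ (# 2 , # 4) ∷ (# 0 , # 5) ∷ (# 3 , # 6) ∷ (# 4 , # 8) ∷ [])
  []

c56 : Certificate 11
c56 = node ((# 0 , # 2) ∷ (# 0 , # 5) ∷ (# 2 , # 7) ∷ (# 6 , # 7) ∷ (# 2 , # 9) ∷ (# 4 , # 9) ∷ (# 4 , # 10) ∷ [])
  []

c55 : Certificate 11
c55 = node ((# 0 , # 4) ∷ (# 0 , # 5) ∷ (# 2 , # 6) ∷ (# 3 , # 6) ∷ (# 2 , # 7) ∷ (# 3 , # 8) ∷ (# 9 , # 10) ∷ [])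
  []

c54 : Certificate 12
c54 = node ((# 0 , # 3) ∷ (# 2 , # 5) ∷ (# 4 , # 5) ∷ (# 3 , # 6) ∷ (# 3 , # 8) ∷ (# 2 , # 9) ∷ (# 2 , # 10) ∷ [])
  []

c53 : Certificate 11
c53 = node ((# 2 , # 4) ∷ (# 0 , # 5) ∷ (# 1 , # 5) ∷ (# 2 , # 6) ∷ (# 4 , # 6) ∷ (# 2 , # 7) ∷ (# 3 , # 9) ∷ [])
  (branch (# 2 ∷ # 3 ∷ # 5 ∷ # 8 ∷ []) 1 c54 ∷ branch (# 0 ∷ # 3 ∷ # 6 ∷ # 7 ∷ # 10 ∷ []) 0 c55 ∷ branch (# 0 ∷ # 4 ∷ # 7 ∷ # 9 ∷ # 10 ∷ []) 0 c56 ∷ branch (# 2 ∷ # 3 ∷ # 5 ∷ # 8 ∷ # 10 ∷ []) 0 c57 ∷ [])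

c52 : Certificate 11
c52 = node ((# 0 , # 2) ∷ (# 0 , # 5) ∷ (# 2 , # 6) ∷ (# 3 , # 6) ∷ (# 2 , # 8) ∷ (# 4 , # 8) ∷ (# 2 , # 9) ∷ [])
  []

c51 : Certificate 11
c51 = node ((# 1 , # 2) ∷ (# 1 , # 6) ∷ (# 0 , # 7) ∷ (# 2 , # 7) ∷ (# 2 , # 9) ∷ (# 4 , # 9) ∷ (# 2 , # 10) ∷ [])
  []

c50 : Certificate 11
c50 = node ((# 2 , # 4) ∷ (# 2 , # 5) ∷ (# 1 , # 6) ∷ (# 2 , # 6) ∷ (# 0 , # 7) ∷ (# 2 , # 7) ∷ (# 4 , # 8) ∷ [])
  []

c49 : Certificate 10
c49 = node ((# 0 , # 2) ∷ (# 1 , # 5) ∷ (# 0 , # 6) ∷ (# 2 , # 6) ∷ (# 3 , # 7) ∷ (# 4 , # 8) ∷ (# 4 , # 9) ∷ [])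
  (branch (# 1 ∷ # 2 ∷ # 7 ∷ # 8 ∷ []) 1 c50 ∷ branch (# 1 ∷ # 2 ∷ # 7 ∷ # 9 ∷ []) 1 c51 ∷ branch (# 2 ∷ # 3 ∷ # 5 ∷ # 8 ∷ []) 1 c52 ∷ branch (# 2 ∷ # 3 ∷ # 5 ∷ # 9 ∷ []) 1 c53 ∷ branch (# 1 ∷ # 2 ∷ # 7 ∷ # 8 ∷ # 9 ∷ []) 0 c58 ∷ branch (# 2 ∷ # 3 ∷ # 5 ∷ # 8 ∷ # 9 ∷ []) 0 c59 ∷ [])

c48 : Certificate 8
c48 = node ((# 2 , # 3) ∷ (# 2 , # 4) ∷ (# 3 , # 4) ∷ (# 0 , # 5) ∷ (# 1 , # 5) ∷ (# 1 , # 6) ∷ (# 0 , # 7) ∷ [])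
  (branch (# 0 ∷ # 2 ∷ # 6 ∷ []) 2 c49 ∷ branch (# 0 ∷ # 4 ∷ # 6 ∷ []) 2 c60 ∷ branch (# 1 ∷ # 2 ∷ # 7 ∷ []) 2 c68 ∷ branch (# 1 ∷ # 4 ∷ # 7 ∷ []) 2 c75 ∷ [])

c47 : Certificate 10
c47 = node ((# 2 , # 4) ∷ (# 3 , # 4) ∷ (# 1 , # 5) ∷ (# 4 , # 5) ∷ (# 3 , # 7) ∷ (# 2 , # 8) ∷ (# 6 , # 9) ∷ [])
  []

c46 : Certificate 10
c46 = node ((# 0 , # 4) ∷ (# 2 , # 4) ∷ (# 3 , # 4) ∷ (# 1 , # 5) ∷ (# 3 , # 7) ∷ (# 6 , # 8) ∷ (# 2 , # 9) ∷ [])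
  []

c45 : Certificate 11
c45 = node ((# 1 , # 3) ∷ (# 1 , # 4) ∷ (# 3 , # 4) ∷ (# 2 , # 5) ∷ (# 2 , # 6) ∷ (# 2 , # 7) ∷ (# 4 , # 10) ∷ [])
  []

c44 : Certificate 10
c44 = node ((# 0 , # 2) ∷ (# 4 , # 5) ∷ (# 4 , # 6) ∷ (# 3 , # 7) ∷ (# 4 , # 7) ∷ (# 1 , # 8) ∷ (# 1 , # 9) ∷ [])
  (branch (# 1 ∷ # 2 ∷ # 3 ∷ # 4 ∷ []) 1 c45 ∷ branch (# 2 ∷ # 3 ∷ # 5 ∷ # 6 ∷ # 8 ∷ []) 0 c46 ∷ branch (# 2 ∷ # 3 ∷ # 5 ∷ # 6 ∷ # 9 ∷ []) 0 c47 ∷ [])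

c43 : Certificate 10
c43 = node ((# 0 , # 3) ∷ (# 3 , # 5) ∷ (# 0 , # 6) ∷ (# 5 , # 6) ∷ (# 4 , # 8) ∷ (# 1 , # 9) ∷ (# 4 , # 9) ∷ [])
  []

c42 : Certificate 11
c42 = node ((# 1 , # 4) ∷ (# 4 , # 5) ∷ (# 2 , # 6) ∷ (# 4 , # 6) ∷ (# 3 , # 7) ∷ (# 4 , # 7) ∷ (# 1 , # 9) ∷ [])
  []

c41 : Certificate 11
c41 = node ((# 2 , # 4) ∷ (# 2 , # 6) ∷ (# 3 , # 7) ∷ (# 4 , # 7) ∷ (# 1 , # 8) ∷ (# 4 , # 8) ∷ (# 4 , # 10) ∷ [])
  []

c40 : Certificate 11
c40 = node ((# 1 , # 4) ∷ (# 4 , # 5) ∷ (# 2 , # 6) ∷ (# 4 , # 6) ∷ (# 3 , # 7) ∷ (# 1 , # 8) ∷ (# 7 , # 10) ∷ [])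
  []

c39 : Certificate 11
c39 = node ((# 1 , # 2) ∷ (# 0 , # 6) ∷ (# 1 , # 7) ∷ (# 2 , # 7) ∷ (# 3 , # 8) ∷ (# 4 , # 8) ∷ (# 4 , # 9) ∷ [])
  []

c38 : Certificate 12
c38 = node ((# 2 , # 4) ∷ (# 2 , # 7) ∷ (# 4 , # 7) ∷ (# 1 , # 8) ∷ (# 4 , # 8) ∷ (# 1 , # 10) ∷ (# 4 , # 10) ∷ [])
  []

c37 : Certificate 11
c37 = node ((# 2 , # 4) ∷ (# 2 , # 5) ∷ (# 1 , # 6) ∷ (# 0 , # 7) ∷ (# 3 , # 7) ∷ (# 4 , # 8) ∷ (# 4 , # 10) ∷ [])
  (branch (# 1 ∷ # 4 ∷ # 7 ∷ # 9 ∷ []) 1 c38 ∷ branch (# 1 ∷ # 2 ∷ # 7 ∷ # 8 ∷ # 9 ∷ []) 0 c39 ∷ branch (# 1 ∷ # 3 ∷ # 5 ∷ # 8 ∷ # 10 ∷ []) 0 c40 ∷ branch (# 1 ∷ # 4 ∷ # 5 ∷ # 7 ∷ # 9 ∷ []) 0 c41 ∷ [])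

c36 : Certificate 11
c36 = node ((# 3 , # 4) ∷ (# 3 , # 5) ∷ (# 0 , # 6) ∷ (# 4 , # 6) ∷ (# 4 , # 8) ∷ (# 1 , # 9) ∷ (# 4 , # 9) ∷ [])
  []

c35 : Certificate 11
c35 = node ((# 0 , # 4) ∷ (# 1 , # 4) ∷ (# 2 , # 4) ∷ (# 3 , # 4) ∷ (# 3 , # 5) ∷ (# 0 , # 6) ∷ (# 1 , # 8) ∷ [])
  []

c34 : Certificate 10
c34 = node ((# 3 , # 4) ∷ (# 2 , # 5) ∷ (# 3 , # 6) ∷ (# 4 , # 6) ∷ (# 0 , # 7) ∷ (# 1 , # 8) ∷ (# 1 , # 9) ∷ [])
  (branch (# 0 ∷ # 4 ∷ # 5 ∷ # 8 ∷ []) 1 c35 ∷ branch (# 0 ∷ # 4 ∷ # 5 ∷ # 9 ∷ []) 1 c36 ∷ branch (# 2 ∷ # 4 ∷ # 7 ∷ # 8 ∷ []) 1 c37 ∷ branch (# 2 ∷ # 4 ∷ # 7 ∷ # 9 ∷ []) 1 c42 ∷ branch (# 0 ∷ # 4 ∷ # 5 ∷ # 8 ∷ # 9 ∷ []) 0 c43 ∷ branch (# 2 ∷ # 4 ∷ # 7 ∷ # 8 ∷ # 9 ∷ []) 0 c44 ∷ [])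

c33 : Certificate 10
c33 = node ((# 1 , # 2) ∷ (# 1 , # 3) ∷ (# 2 , # 3) ∷ (# 1 , # 5) ∷ (# 2 , # 6) ∷ (# 3 , # 7) ∷ (# 4 , # 8) ∷ [])
  []

c32 : Certificate 10
c32 = node ((# 3 , # 4) ∷ (# 1 , # 6) ∷ (# 2 , # 6) ∷ (# 0 , # 7) ∷ (# 1 , # 8) ∷ (# 2 , # 8) ∷ (# 4 , # 9) ∷ [])
  []

c31 : Certificate 11
c31 = node ((# 1 , # 2) ∷ (# 1 , # 3) ∷ (# 1 , # 5) ∷ (# 4 , # 5) ∷ (# 2 , # 6) ∷ (# 3 , # 7) ∷ (# 1 , # 10) ∷ [])
  []

c30 : Certificate 10
c30 = node ((# 0 , # 1) ∷ (# 1 , # 4) ∷ (# 2 , # 6) ∷ (# 3 , # 7) ∷ (# 1 , # 8) ∷ (# 1 , # 9) ∷ (# 4 , # 9) ∷ [])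
  (branch (# 1 ∷ # 2 ∷ # 3 ∷ # 5 ∷ []) 1 c31 ∷ branch (# 0 ∷ # 4 ∷ # 6 ∷ # 7 ∷ # 8 ∷ []) 0 c32 ∷ branch (# 2 ∷ # 3 ∷ # 4 ∷ # 5 ∷ # 8 ∷ []) 0 c33 ∷ [])

c29 : Certificate 10
c29 = node ((# 0 , # 3) ∷ (# 3 , # 5) ∷ (# 0 , # 6) ∷ (# 5 , # 6) ∷ (# 1 , # 8) ∷ (# 4 , # 8) ∷ (# 1 , # 9) ∷ [])
  []

c28 : Certificate 11
c28 = node ((# 1 , # 4) ∷ (# 2 , # 4) ∷ (# 2 , # 5) ∷ (# 3 , # 7) ∷ (# 1 , # 9) ∷ (# 4 , # 9) ∷ (# 1 , # 10) ∷ [])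
  []

c27 : Certificate 11
c27 = node ((# 2 , # 4) ∷ (# 1 , # 5) ∷ (# 1 , # 6) ∷ (# 2 , # 7) ∷ (# 0 , # 9) ∷ (# 3 , # 9) ∷ (# 3 , # 10) ∷ [])
  []

c26 : Certificate 11
c26 = node ((# 0 , # 4) ∷ (# 2 , # 6) ∷ (# 1 , # 7) ∷ (# 3 , # 7) ∷ (# 1 , # 8) ∷ (# 1 , # 9) ∷ (# 4 , # 9) ∷ [])
  []

c25 : Certificate 11
c25 = node ((# 0 , # 1) ∷ (# 2 , # 6) ∷ (# 1 , # 7) ∷ (# 3 , # 7) ∷ (# 1 , # 8) ∷ (# 4 , # 9) ∷ (# 7 , # 9) ∷ [])
  []

c24 : Certificate 11
c24 = node ((# 0 , # 1) ∷ (# 1 , # 2) ∷ (# 1 , # 3) ∷ (# 1 , # 4) ∷ (# 4 , # 6) ∷ (# 3 , # 7) ∷ (# 2 , # 9) ∷ [])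
  (branch (# 0 ∷ # 2 ∷ # 6 ∷ # 7 ∷ # 8 ∷ []) 0 c25 ∷ branch (# 0 ∷ # 4 ∷ # 7 ∷ # 8 ∷ # 9 ∷ []) 0 c26 ∷ branch (# 2 ∷ # 3 ∷ # 5 ∷ # 6 ∷ # 10 ∷ []) 0 c27 ∷ branch (# 3 ∷ # 4 ∷ # 5 ∷ # 9 ∷ # 10 ∷ []) 0 c28 ∷ [])

c23 : Certificate 11
c23 = node ((# 1 , # 2) ∷ (# 2 , # 6) ∷ (# 1 , # 7) ∷ (# 3 , # 7) ∷ (# 1 , # 8) ∷ (# 4 , # 8) ∷ (# 1 , # 10) ∷ [])
  []

c22 : Certificate 11
c22 = node ((# 1 , # 3) ∷ (# 3 , # 5) ∷ (# 0 , # 6) ∷ (# 1 , # 6) ∷ (# 1 , # 8) ∷ (# 1 , # 9) ∷ (# 4 , # 9) ∷ [])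
  []

c21 : Certificate 11
c21 = node ((# 0 , # 1) ∷ (# 1 , # 2) ∷ (# 1 , # 3) ∷ (# 1 , # 4) ∷ (# 3 , # 5) ∷ (# 0 , # 6) ∷ (# 4 , # 8) ∷ [])
  []

c20 : Certificate 10
c20 = node ((# 1 , # 3) ∷ (# 2 , # 5) ∷ (# 1 , # 6) ∷ (# 3 , # 6) ∷ (# 0 , # 7) ∷ (# 4 , # 8) ∷ (# 4 , # 9) ∷ [])
  (branch (# 0 ∷ # 1 ∷ # 5 ∷ # 8 ∷ []) 1 c21 ∷ branch (# 0 ∷ # 1 ∷ # 5 ∷ # 9 ∷ []) 1 c22 ∷ branch (# 1 ∷ # 2 ∷ # 7 ∷ # 8 ∷ []) 1 c23 ∷ branch (# 1 ∷ # 2 ∷ # 7 ∷ # 9 ∷ []) 1 c24 ∷ branch (# 0 ∷ # 1 ∷ # 5 ∷ # 8 ∷ # 9 ∷ []) 0 c29 ∷ branch (# 1 ∷ # 2 ∷ # 7 ∷ # 8 ∷ # 9 ∷ []) 0 c30 ∷ [])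

c19 : Certificate 10
c19 = node ((# 2 , # 4) ∷ (# 3 , # 4) ∷ (# 0 , # 6) ∷ (# 1 , # 6) ∷ (# 3 , # 7) ∷ (# 0 , # 8) ∷ (# 1 , # 8) ∷ [])
  []

c18 : Certificate 10
c18 = node ((# 2 , # 4) ∷ (# 3 , # 4) ∷ (# 0 , # 5) ∷ (# 1 , # 5) ∷ (# 2 , # 7) ∷ (# 0 , # 9) ∷ (# 1 , # 9) ∷ [])
  []

c17 : Certificate 11
c17 = node ((# 3 , # 4) ∷ (# 5 , # 6) ∷ (# 3 , # 7) ∷ (# 4 , # 7) ∷ (# 1 , # 8) ∷ (# 4 , # 8) ∷ (# 4 , # 10) ∷ [])
  []

c16 : Certificate 11
c16 = node ((# 0 , # 1) ∷ (# 0 , # 6) ∷ (# 3 , # 7) ∷ (# 4 , # 7) ∷ (# 1 , # 8) ∷ (# 4 , # 9) ∷ (# 3 , # 10) ∷ [])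
  []

c15 : Certificate 11
c15 = node ((# 0 , # 4) ∷ (# 0 , # 6) ∷ (# 4 , # 6) ∷ (# 1 , # 7) ∷ (# 3 , # 7) ∷ (# 1 , # 8) ∷ (# 4 , # 9) ∷ [])
  []

c14 : Certificate 12
c14 = node ((# 0 , # 4) ∷ (# 1 , # 4) ∷ (# 2 , # 4) ∷ (# 3 , # 4) ∷ (# 0 , # 6) ∷ (# 3 , # 7) ∷ (# 1 , # 8) ∷ [])
  []

c13 : Certificate 11
c13 = node ((# 0 , # 4) ∷ (# 3 , # 6) ∷ (# 0 , # 7) ∷ (# 4 , # 7) ∷ (# 1 , # 8) ∷ (# 2 , # 8) ∷ (# 4 , # 9) ∷ [])
  (branch (# 3 ∷ # 4 ∷ # 5 ∷ # 8 ∷ []) 1 c14 ∷ branch (# 0 ∷ # 1 ∷ # 6 ∷ # 9 ∷ # 10 ∷ []) 0 c15 ∷ branch (# 1 ∷ # 3 ∷ # 7 ∷ # 9 ∷ # 10 ∷ []) 0 c16 ∷ branch (# 3 ∷ # 4 ∷ # 5 ∷ # 8 ∷ # 10 ∷ []) 0 c17 ∷ [])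

c12 : Certificate 11
c12 = node ((# 0 , # 4) ∷ (# 0 , # 5) ∷ (# 3 , # 7) ∷ (# 4 , # 7) ∷ (# 4 , # 8) ∷ (# 1 , # 9) ∷ (# 4 , # 9) ∷ [])
  []

c11 : Certificate 11
c11 = node ((# 0 , # 4) ∷ (# 0 , # 6) ∷ (# 2 , # 7) ∷ (# 4 , # 7) ∷ (# 1 , # 8) ∷ (# 4 , # 8) ∷ (# 4 , # 9) ∷ [])
  []

c10 : Certificate 11
c10 = node ((# 1 , # 4) ∷ (# 0 , # 5) ∷ (# 4 , # 5) ∷ (# 4 , # 6) ∷ (# 2 , # 7) ∷ (# 4 , # 7) ∷ (# 1 , # 9) ∷ [])
  []

c9 : Certificate 10
c9 = node ((# 0 , # 1) ∷ (# 0 , # 4) ∷ (# 1 , # 4) ∷ (# 2 , # 7) ∷ (# 3 , # 7) ∷ (# 5 , # 8) ∷ (# 6 , # 9) ∷ [])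
  (branch (# 2 ∷ # 4 ∷ # 5 ∷ # 9 ∷ []) 1 c10 ∷ branch (# 2 ∷ # 4 ∷ # 6 ∷ # 8 ∷ []) 1 c11 ∷ branch (# 3 ∷ # 4 ∷ # 5 ∷ # 9 ∷ []) 1 c12 ∷ branch (# 3 ∷ # 4 ∷ # 6 ∷ # 8 ∷ []) 1 c13 ∷ branch (# 2 ∷ # 3 ∷ # 4 ∷ # 5 ∷ # 9 ∷ []) 0 c18 ∷ branch (# 2 ∷ # 3 ∷ # 4 ∷ # 6 ∷ # 8 ∷ []) 0 c19 ∷ [])

c8 : Certificate 10
c8 = node ((# 1 , # 2) ∷ (# 1 , # 3) ∷ (# 0 , # 6) ∷ (# 4 , # 6) ∷ (# 2 , # 7) ∷ (# 0 , # 9) ∷ (# 4 , # 9) ∷ [])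
  []

c7 : Certificate 10
c7 = node ((# 1 , # 2) ∷ (# 1 , # 3) ∷ (# 0 , # 5) ∷ (# 4 , # 5) ∷ (# 2 , # 7) ∷ (# 0 , # 8) ∷ (# 4 , # 8) ∷ [])
  []

c6 : Certificate 11
c6 = node ((# 1 , # 3) ∷ (# 0 , # 6) ∷ (# 1 , # 6) ∷ (# 3 , # 7) ∷ (# 1 , # 9) ∷ (# 4 , # 9) ∷ (# 1 , # 10) ∷ [])
  []

c5 : Certificate 11
c5 = node ((# 0 , # 1) ∷ (# 1 , # 2) ∷ (# 1 , # 3) ∷ (# 1 , # 4) ∷ (# 0 , # 5) ∷ (# 3 , # 7) ∷ (# 4 , # 8) ∷ [])
  []

c4 : Certificate 11
c4 = node ((# 0 , # 1) ∷ (# 1 , # 2) ∷ (# 1 , # 3) ∷ (# 1 , # 4) ∷ (# 0 , # 6) ∷ (# 2 , # 7) ∷ (# 4 , # 9) ∷ [])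
  []

c3 : Certificate 11
c3 = node ((# 0 , # 1) ∷ (# 0 , # 5) ∷ (# 1 , # 7) ∷ (# 2 , # 7) ∷ (# 1 , # 8) ∷ (# 4 , # 8) ∷ (# 1 , # 9) ∷ [])
  []

c2 : Certificate 10
c2 = node ((# 0 , # 1) ∷ (# 0 , # 4) ∷ (# 1 , # 4) ∷ (# 2 , # 7) ∷ (# 3 , # 7) ∷ (# 6 , # 8) ∷ (# 5 , # 9) ∷ [])
  (branch (# 1 ∷ # 2 ∷ # 5 ∷ # 8 ∷ []) 1 c3 ∷ branch (# 1 ∷ # 2 ∷ # 6 ∷ # 9 ∷ []) 1 c4 ∷ branch (# 1 ∷ # 3 ∷ # 5 ∷ # 8 ∷ []) 1 c5 ∷ branch (# 1 ∷ # 3 ∷ # 6 ∷ # 9 ∷ []) 1 c6 ∷ branch (# 1 ∷ # 2 ∷ # 3 ∷ # 5 ∷ # 8 ∷ []) 0 c7 ∷ branch (# 1 ∷ # 2 ∷ # 3 ∷ # 6 ∷ # 9 ∷ []) 0 c8 ∷ [])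

c1 : Certificate 8
c1 = node ((# 1 , # 4) ∷ (# 1 , # 5) ∷ (# 4 , # 5) ∷ (# 0 , # 6) ∷ (# 2 , # 6) ∷ (# 2 , # 7) ∷ (# 3 , # 7) ∷ [])
  (branch (# 0 ∷ # 1 ∷ # 7 ∷ []) 2 c2 ∷ branch (# 0 ∷ # 4 ∷ # 7 ∷ []) 2 c9 ∷ branch (# 1 ∷ # 3 ∷ # 6 ∷ []) 2 c20 ∷ branch (# 3 ∷ # 4 ∷ # 6 ∷ []) 2 c34 ∷ [])

c0 : Certificate 5
c0 = node ((# 0 , # 1) ∷ (# 0 , # 2) ∷ (# 1 , # 2) ∷ (# 0 , # 3) ∷ (# 1 , # 3) ∷ (# 2 , # 3) ∷ (# 0 , # 4) ∷ [])
  (branch (# 1 ∷ # 4 ∷ []) 3 c1 ∷ branch (# 2 ∷ # 4 ∷ []) 3 c48 ∷ branch (# 3 ∷ # 4 ∷ []) 3 c90 ∷ [])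

root : Certificate 0
root = node []
  (branch [] 5 c0 ∷ [])

root-valid : Valid 5 7 [] root
root-valid = from-yes (valid? 5 7 [] root)

-- The biplane of order 3

biplaneBlock : Fin 11 → Subset 11
biplaneBlock i = subsetOf (List.map (λ d → (toℕ i + d) mod 11) (1 ∷ 3 ∷ 4 ∷ 5 ∷ 9 ∷ []))

biplaneBlocks : List (Subset 11)
biplaneBlocks = List.tabulate biplaneBlock

biplane : Hypergraph 5
biplane = record
  { n       = 11
  ; edges   = biplaneBlocks
  ; uniform = from-yes (All.all? (λ e → ∣ e ∣ ≟ 5) biplaneBlocks)
  }

biplane-intersections : All (λ e → All (λ f → e ≡ f ⊎ 2 ≤ ∣ e ∩ f ∣) biplaneBlocks) biplaneBlocks
biplane-intersections =
  from-yes (All.all? (λ e → All.all? (λ f → e ≟ₛ f ⊎-dec 2 ≤? ∣ e ∩ f ∣) biplaneBlocks) biplaneBlocks)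

biplane-intersecting : ∀ {e f} → e ∈ₗ biplaneBlocks → f ∈ₗ biplaneBlocks → e ≢ f → 2 ≤ ∣ e ∩ f ∣
biplane-intersecting e∈ f∈ e≢f =
  fromInj₂ (λ e≡f → contradiction e≡f e≢f) (All.lookup (All.lookup biplane-intersections e∈) f∈)

biplane-pairDegree : ∀ c → ∣ c ∣ ≡ 2 → length (filter (c ⊆?_) biplaneBlocks) ≤ 2
biplane-pairDegree c ∣c∣≡2 = degrees c (≤-reflexive ∣c∣≡2) ∣c∣≡2
  where
  degrees : ∀ c → ∣ c ∣ ≤ 2 → ∣ c ∣ ≡ 2 → length (filter (c ⊆?_) biplaneBlocks) ≤ 2
  degrees = from-yes (∀-subset≤? 2 (λ c → ∣ c ∣ ≟ 2 →-dec length (filter (c ⊆?_) biplaneBlocks) ≤? 2))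

biplane-matchingNumber : MatchingNumber biplane 2 1
biplane-matchingNumber = intersecting⇒matchingNumber≡1 biplane (here refl) biplane-intersecting

biplane-coverNumber : CoverNumber biplane 2 6
biplane-coverNumber = (sixPairs , from-yes (isCover? biplane 2 sixPairs) , refl) , minimal
  where
  sixPairs : List (Subset 11)
  sixPairs = List.map subsetOf
    ((# 0 ∷ # 1 ∷ []) ∷ (# 0 ∷ # 2 ∷ []) ∷ (# 0 ∷ # 7 ∷ []) ∷ (# 1 ∷ # 3 ∷ []) ∷ (# 2 ∷ # 5 ∷ []) ∷ (# 6 ∷ # 8 ∷ []) ∷ [])
  minimal : ∀ C → IsCover biplane 2 C → 6 ≤ length C
  minimal C (_ , sizes , covers) =
    *-cancelʳ-< 2 5 (length C)
      (double-counting 2 C biplaneBlocks covers (All.map (λ {c} → biplane-pairDegree c) sizes))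

coverNumber≤7 : (H : Hypergraph 5) → MatchingNumber H 2 1 → ∃ λ C → IsCover H 2 C × length C ≤ 7
coverNumber≤7 H ν≡1 =
  Soundness.valid⇒smallCover H 7 (matchingNumber≡1⇒intersecting H (s≤s (s≤s z≤n)) ν≡1) {c = root} root-valid

theorem5 :
    -- g_1(5,2) ≥ 6 : some 5-uniform H with ν^(2)(H) = 1 has τ^(2)(H) ≥ 6
    Σ (Hypergraph 5) (λ H → Σ ℕ (λ t → MatchingNumber H 2 1 × CoverNumber H 2 t × 6 ≤ t))
    ×
    -- g_1(5,2) ≤ 7 : every 5-uniform H with ν^(2)(H) = 1 has τ^(2)(H) ≤ 7
    ((H : Hypergraph 5) (t : ℕ) → MatchingNumber H 2 1 → CoverNumber H 2 t → t ≤ 7)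
theorem5 = (biplane , 6 , biplane-matchingNumber , biplane-coverNumber , ≤-refl) , τ≤7
  where
  τ≤7 : (H : Hypergraph 5) (t : ℕ) → MatchingNumber H 2 1 → CoverNumber H 2 t → t ≤ 7
  τ≤7 H t ν≡1 (_ , minimal) =
    let C , isCover , length≤7 = coverNumber≤7 H ν≡1 in ≤-trans (minimal C isCover) length≤7
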